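{- Let $v$ be a vertex of degree at least $4$ of a graph $G$, and let $va,vb\in E_G(v)$ be two distinct edges with $a\ne b$. Let $G_{[v,ab]}=G-v+ab$ be the graph obtained from $G$ by deleting $v$ and adding a new edge $ab$. If $G_{[v,ab]}\in\mathcal{S}_3$, then $G\in\mathcal{S}_3$.
   Context: Graphs may have parallel edges but no loops. $E_G(v)$ is the set of edges incident with $v$. $Z(G,\mathbb{Z}_3)$ is the set of $\beta:V(G)\to\mathbb{Z}_3$ with $\sum_v\beta(v)\equiv0\pmod 3$; a $\beta$-orientation is an orientation $D$ with $d^+_D(v)-d^-_D(v)\equiv\beta(v)\pmod 3$ for all $v$; $\mathcal{S}_3$ is the family of graphs admitting a strongly-connected $\beta$-orientation for every $\beta\in Z(G,\mathbb{Z}_3)$. -}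

module Defs where

open import Data.Nat using (ℕ; zero; suc; _+_; _≤_; _%_)
open import Data.Fin using (Fin; toℕ; punchOut; _≟_)
open import Data.Fin.Base using ()
open import Data.Product using (_×_; _,_; proj₁; proj₂; ∃)
open import Data.Sum using (_⊎_)
open import Data.Bool using (Bool; true; false; if_then_else_)
open import Data.List using (List; []; _∷_; length; lookup; map; allFin)
open import Data.Nat.ListAction using (sum)
open import Data.List.Relation.Unary.All using (All)
open import Data.Integer using (ℤ; +_; _-_)
open import Data.Integer.DivMod using (_%ℕ_)
open import Relation.Binary.PropositionalEquality using (_≡_; _≢_)
open import Relation.Nullary using (yes; no; ¬_)

-- A multigraph on vertex set Fin n: a list of edges, each given by its two
-- endpoints.  Edges are identified by their position in the list, so
-- parallel edges are allowed.
Graph : ℕ → Set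
Graph n = List (Fin n × Fin n)

Loopless : ∀ {n} → Graph n → Set
Loopless G = All (λ e → proj₁ e ≢ proj₂ e) G

Edge : ∀ {n} → Graph n → Set
Edge G = Fin (length G)

Joins : ∀ {n} (G : Graph n) → Edge G → Fin n → Fin n → Set
Joins G e x y = lookup G e ≡ (x , y) ⊎ lookup G e ≡ (y , x)

countE : ∀ {n} → (Fin n × Fin n → Bool) → Graph n → ℕ
countE p [] = 0
countE p (e ∷ es) = (if p e then 1 else 0) + countE p es

isV : ∀ {n} → Fin n → Fin n → Bool
isV v x with x ≟ v
... | yes _ = true
... | no _ = false

incident : ∀ {n} → Fin n → Fin n × Fin n → Bool
incident v (x , y) = if isV v x then true else isV v y

-- degree d_G(v) = |E_G(v)| (graph has no loops, so each incident edge counts once)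
deg : ∀ {n} → Graph n → Fin n → ℕ
deg G v = countE (incident v) G

-- An orientation: true means e = (x , y) is directed x → y, false means y → x.
Orientation : ∀ {n} → Graph n → Set
Orientation G = Edge G → Bool

tail head : ∀ {n} (G : Graph n) → Orientation G → Edge G → Fin n
tail G o e = if o e then proj₁ (lookup G e) else proj₂ (lookup G e)
head G o e = if o e then proj₂ (lookup G e) else proj₁ (lookup G e)

countEdges : ∀ {n} (G : Graph n) → (Edge G → Bool) → ℕ
countEdges G p = sum (map (λ e → if p e then 1 else 0) (allFin (length G)))

outdeg indeg : ∀ {n} (G : Graph n) → Orientation G → Fin n → ℕ
outdeg G o v = countEdges G (λ e → isV v (tail G o e))
indeg G o v = countEdges G (λ e → isV v (head G o e))

ZeroSum3 : ∀ {n} → (Fin n → Fin 3) → Set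
ZeroSum3 {n} β = sum (map (λ v → toℕ (β v)) (allFin n)) % 3 ≡ 0

IsBetaOrientation : ∀ {n} (G : Graph n) → Orientation G → (Fin n → Fin 3) → Set
IsBetaOrientation {n} G o β =
  (v : Fin n) → ((+ outdeg G o v) - (+ indeg G o v)) %ℕ 3 ≡ toℕ (β v)

data Reach {n} (G : Graph n) (o : Orientation G) : Fin n → Fin n → Set where
  here : ∀ {x} → Reach G o x x
  step : ∀ {x y} (e : Edge G) → tail G o e ≡ x → Reach G o (head G o e) y → Reach G o x y

StronglyConnected : ∀ {n} (G : Graph n) → Orientation G → Set
StronglyConnected {n} G o = (x y : Fin n) → Reach G o x y

S3 : ∀ {n} → Graph n → Set
S3 {n} G = (β : Fin n → Fin 3) → ZeroSum3 β →
  ∃ λ (o : Orientation G) → IsBetaOrientation G o β × StronglyConnected G o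

-- G - v : delete v and all its incident edges, renumbering the remaining
-- vertices Fin (suc n) ∖ {v} ≅ Fin n via punchOut.
deleteV : ∀ {n} → Fin (suc n) → Graph (suc n) → Graph n
deleteV v [] = []
deleteV v ((x , y) ∷ es) with v ≟ x | v ≟ y
... | no v≢x | no v≢y = (punchOut v≢x , punchOut v≢y) ∷ deleteV v es
... | _ | _ = deleteV v es

liftAt : ∀ {n} (G : Graph (suc n)) (v a b : Fin (suc n)) → v ≢ a → v ≢ b → Graph n
liftAt G v a b v≢a v≢b = (punchOut v≢a , punchOut v≢b) ∷ deleteV v G

module Submission where

-- Let β ∈ Z(G, ℤ₃).  Besides va and vb, v has at least two edges; orient them so
-- that their net outflow R at v is β(v) modulo 3 (orient-star).  The reduced demand
-- β' = β - R on G - v again sums to 0 (reduce-zeroSum), so G_[v,ab] has a strongly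
-- connected β'-orientation o'.  If o' directs ab from a to b, direct va as a → v and vb
-- as v → b (otherwise the reverse), and orient the edges avoiding v as o' does (glue).
-- The path a → v → b has the net outflow of the arc a → b, so the result is a
-- β-orientation (glued-isBeta); every arc of o' is realised by a walk, so it is strongly
-- connected (glued-strong).

open import Defs
open import Data.Nat as ℕ using (ℕ; zero; suc; _≤_; _<_; z≤n; s≤s)
import Data.Nat.ListAction as ℕList
import Data.Nat.Properties as ℕP
open import Data.Fin using (Fin; zero; suc; toℕ; punchIn; punchOut; fromℕ<; _≟_)
open import Data.Fin.Properties using (punchIn-injective; punchInᵢ≢i; punchIn-punchOut; toℕ-fromℕ<; toℕ<n)
open import Data.Integer using (ℤ; +_; -[1+_]; _+_; _-_; _*_; -_)
open import Data.Integer.DivMod using (_%ℕ_; _/ℕ_; a≡a%ℕn+[a/ℕn]*n; n%ℕd<d)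
import Data.Integer.Properties as ℤP
open import Data.Integer.Solver using (module +-*-Solver)
open +-*-Solver
open import Data.Bool using (Bool; true; false; if_then_else_)
open import Data.List using ([]; _∷_; length; lookup; map; allFin; tabulate)
open import Data.List.Properties using (map-tabulate)
open import Data.Vec.Functional using () renaming (_∷_ to _∷ᶠ_)
import Data.List.Relation.Unary.All as All
open import Data.List.Membership.Propositional.Properties using (∈-lookup)
open import Data.Product using (_×_; _,_; proj₁; proj₂; ∃)
open import Data.Sum using (inj₁; inj₂)
open import Data.Empty using (⊥-elim)
open import Function using (_∘_; id)
open import Relation.Binary using (Setoid)
import Relation.Binary.Reasoning.Setoid
open import Relation.Binary.PropositionalEquality
open import Relation.Nullary using (yes; no; does)
open import Relation.Nullary.Decidable using (dec-true; dec-false)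
open import Algebra.Properties.CommutativeSemigroup ℤP.+-commutativeSemigroup using (x∙yz≈y∙xz)
open import Algebra.Properties.CommutativeMonoid.Sum ℤP.+-0-commutativeMonoid
  using (sum-remove; ∑-distrib-+; ∑-comm; sum-replicate-zero; sum-cong-≗)
  renaming (sum to Σ)

Σ-neg : ∀ {m} (f : Fin m → ℤ) → Σ (λ i → - f i) ≡ - Σ f
Σ-neg {zero} f = refl
Σ-neg {suc m} f = begin
  - f zero + Σ (λ i → - f (suc i)) ≡⟨ cong (_+_ (- f zero)) (Σ-neg (f ∘ suc)) ⟩
  - f zero + - Σ (f ∘ suc)         ≡⟨ ℤP.neg-distrib-+ (f zero) (Σ (f ∘ suc)) ⟨
  - (f zero + Σ (f ∘ suc))         ∎
  where open ≡-Reasoning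

Σ-distrib-- : ∀ {m} (f g : Fin m → ℤ) → Σ (λ i → f i - g i) ≡ Σ f - Σ g
Σ-distrib-- f g = trans (∑-distrib-+ f (λ i → - g i)) (cong (_+_ (Σ f)) (Σ-neg g))

sumList-tabulate : ∀ {m} (g : Fin m → ℕ) → + ℕList.sum (tabulate g) ≡ Σ (λ i → + g i)
sumList-tabulate {zero} g = refl
sumList-tabulate {suc m} g =
  trans (ℤP.pos-+ (g zero) _) (cong (_+_ (+ g zero)) (sumList-tabulate (g ∘ suc)))

sumList-allFin : ∀ m (g : Fin m → ℕ) → + ℕList.sum (map g (allFin m)) ≡ Σ (λ i → + g i)
sumList-allFin m g = trans (cong (λ l → + ℕList.sum l) (map-tabulate id g)) (sumList-tabulate g)

infix 4 _≡₃_
data _≡₃_ (x y : ℤ) : Set where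
  mod3 : (k : ℤ) → x ≡ y + k * + 3 → x ≡₃ y

≡₃-reflexive : ∀ {x y} → x ≡ y → x ≡₃ y
≡₃-reflexive {y = y} refl = mod3 (+ 0) (solve 1 (λ y → y := y :+ con (+ 0) :* con (+ 3)) refl y)

≡₃-sym : ∀ {x y} → x ≡₃ y → y ≡₃ x
≡₃-sym {y = y} (mod3 k refl) =
  mod3 (- k) (solve 2 (λ y k → y := (y :+ k :* con (+ 3)) :+ (:- k) :* con (+ 3)) refl y k)

≡₃-trans : ∀ {x y z} → x ≡₃ y → y ≡₃ z → x ≡₃ z
≡₃-trans {z = z} (mod3 k refl) (mod3 l refl) =
  mod3 (l + k) (solve 3 (λ z k l → (z :+ l :* con (+ 3)) :+ k :* con (+ 3) := z :+ (l :+ k) :* con (+ 3)) refl z k l)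

≡₃-setoid : Setoid _ _
≡₃-setoid = record
  { Carrier = ℤ ; _≈_ = _≡₃_
  ; isEquivalence = record { refl = ≡₃-reflexive refl ; sym = ≡₃-sym ; trans = ≡₃-trans } }

module ≡₃-Reasoning = Relation.Binary.Reasoning.Setoid ≡₃-setoid

≡₃-+ : ∀ {x x' y y'} → x ≡₃ x' → y ≡₃ y' → x + y ≡₃ x' + y'
≡₃-+ {x' = x'} {y' = y'} (mod3 k refl) (mod3 l refl) =
  mod3 (k + l) (solve 4 (λ x y k l → (x :+ k :* con (+ 3)) :+ (y :+ l :* con (+ 3))
                                   := (x :+ y) :+ (k :+ l) :* con (+ 3)) refl x' y' k l)

≡₃-neg : ∀ {x y} → x ≡₃ y → - x ≡₃ - y
≡₃-neg {y = y} (mod3 k refl) =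
  mod3 (- k) (solve 2 (λ y k → :- (y :+ k :* con (+ 3)) := (:- y) :+ (:- k) :* con (+ 3)) refl y k)

≡₃-- : ∀ {x x' y y'} → x ≡₃ x' → y ≡₃ y' → x - y ≡₃ x' - y'
≡₃-- p q = ≡₃-+ p (≡₃-neg q)

Σ-≡₃ : ∀ {m} {f g : Fin m → ℤ} → (∀ i → f i ≡₃ g i) → Σ f ≡₃ Σ g
Σ-≡₃ {zero} p = ≡₃-reflexive refl
Σ-≡₃ {suc m} p = ≡₃-+ (p zero) (Σ-≡₃ (p ∘ suc))

≡₃-residue : ∀ x → x ≡₃ + (x %ℕ 3)
≡₃-residue x = mod3 (x /ℕ 3) (a≡a%ℕn+[a/ℕn]*n x 3)

residue-unique : ∀ r s k → r < 3 → s < 3 → + r ≡ + s + k * + 3 → r ≡ s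
residue-unique 0 0 _ _ _ _ = refl
residue-unique 1 1 _ _ _ _ = refl
residue-unique 2 2 _ _ _ _ = refl
residue-unique 0 1 (+ zero) _ _ ()
residue-unique 0 1 (+ suc k) _ _ ()
residue-unique 0 1 -[1+ k ] _ _ ()
residue-unique 0 2 (+ zero) _ _ ()
residue-unique 0 2 (+ suc k) _ _ ()
residue-unique 0 2 -[1+ k ] _ _ ()
residue-unique 1 0 (+ zero) _ _ ()
residue-unique 1 0 (+ suc k) _ _ ()
residue-unique 1 0 -[1+ k ] _ _ ()
residue-unique 1 2 (+ zero) _ _ ()
residue-unique 1 2 (+ suc k) _ _ ()
residue-unique 1 2 -[1+ k ] _ _ ()
residue-unique 2 0 (+ zero) _ _ ()
residue-unique 2 0 (+ suc k) _ _ ()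
residue-unique 2 0 -[1+ k ] _ _ ()
residue-unique 2 1 (+ zero) _ _ ()
residue-unique 2 1 (+ suc k) _ _ ()
residue-unique 2 1 -[1+ k ] _ _ ()
residue-unique (suc (suc (suc _))) _ _ (s≤s (s≤s (s≤s ()))) _ _
residue-unique _ (suc (suc (suc _))) _ _ (s≤s (s≤s (s≤s ()))) _

≡₃⇒residue : ∀ {x r} → r < 3 → x ≡₃ + r → x %ℕ 3 ≡ r
≡₃⇒residue {x} {r} r<3 x≡r with ≡₃-trans (≡₃-sym (≡₃-residue x)) x≡r
... | mod3 k eq = residue-unique (x %ℕ 3) r k (n%ℕd<d x 3) r<3 eq

isV-refl : ∀ {k} (v : Fin k) → isV v v ≡ true
isV-refl v with v ≟ v
... | yes _ = refl
... | no v≢v = ⊥-elim (v≢v refl)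

isV-≢ : ∀ {k} {v x : Fin k} → x ≢ v → isV v x ≡ false
isV-≢ {v = v} {x} x≢v with x ≟ v
... | yes x≡v = ⊥-elim (x≢v x≡v)
... | no _ = refl

isV-true : ∀ {k} {v x : Fin k} → isV v x ≡ true → x ≡ v
isV-true {v = v} {x} eq with x ≟ v
... | yes x≡v = x≡v
isV-true () | no _

isV-false : ∀ {k} {v x : Fin k} → isV v x ≡ false → x ≢ v
isV-false {v = v} x? refl with () ← trans (sym (isV-refl v)) x?

-- punchIn v is injective, so it preserves vertex tests.
isV-punchIn : ∀ {k} (v : Fin (suc k)) (w x : Fin k) → isV (punchIn v w) (punchIn v x) ≡ isV w x
isV-punchIn v w x with isV w x in x?
... | true rewrite isV-true x? = isV-refl (punchIn v w)
... | false = isV-≢ (isV-false x? ∘ punchIn-injective v x w)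

ind : Bool → ℤ
ind true = + 1
ind false = + 0

δ : ∀ {k} → Fin k → Fin k × Fin k → ℤ
δ u (t , h) = ind (isV u t) - ind (isV u h)

orient : ∀ {k} → Fin k × Fin k → Bool → Fin k × Fin k
orient (x , y) b = (if b then x else y) , (if b then y else x)

arc : ∀ {k} (G : Graph k) → Orientation G → Edge G → Fin k × Fin k
arc G o e = tail G o e , head G o e

net : ∀ {k} (G : Graph k) → Orientation G → Fin k → ℤ
net G o u = Σ (λ e → δ u (arc G o e))

Joins-sym : ∀ {k} {G : Graph k} {e x y} → Joins G e x y → Joins G e y x
Joins-sym (inj₁ eq) = inj₂ eq
Joins-sym (inj₂ eq) = inj₁ eq

Joins⇒orient : ∀ {k} {G : Graph k} {e x y} → Joins G e x y → ∃ λ b → orient (lookup G e) b ≡ (x , y)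
Joins⇒orient (inj₁ eq) rewrite eq = true , refl
Joins⇒orient (inj₂ eq) rewrite eq = false , refl

δ-path : ∀ {k} (u t w h : Fin k) → δ u (t , w) + δ u (w , h) ≡ δ u (t , h)
δ-path u t w h =
  solve 3 (λ T W H → (T :- W) :+ (W :- H) := T :- H) refl (ind (isV u t)) (ind (isV u w)) (ind (isV u h))

-- Every arc leaves one vertex and enters one vertex, so its total contribution vanishes.
Σ-ind-isV : ∀ {k} (t : Fin k) → Σ (λ u → ind (isV u t)) ≡ + 1
Σ-ind-isV {suc k} t = begin
  Σ (λ u → ind (isV u t))                             ≡⟨ sum-remove {i = t} (λ u → ind (isV u t)) ⟩
  ind (isV t t) + Σ (λ w → ind (isV (punchIn t w) t)) ≡⟨ cong₂ _+_ (cong ind (isV-refl t)) (sum-cong-≗ off-t) ⟩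
  + 1 + Σ {k} (λ _ → + 0)                             ≡⟨ cong (_+_ (+ 1)) (sum-replicate-zero k) ⟩
  + 1                                                 ∎
  where
  open ≡-Reasoning
  off-t : ∀ w → ind (isV (punchIn t w) t) ≡ + 0
  off-t w = cong ind (isV-≢ λ t≡ → punchInᵢ≢i t w (sym t≡))

Σ-δ : ∀ {k} (t h : Fin k) → Σ (λ u → δ u (t , h)) ≡ + 0
Σ-δ t h = trans (Σ-distrib-- (λ u → ind (isV u t)) (λ u → ind (isV u h)))
                (cong₂ _-_ (Σ-ind-isV t) (Σ-ind-isV h))

ind-count : ∀ b → + (if b then 1 else 0) ≡ ind b
ind-count true = refl
ind-count false = refl

outdeg-indeg≡net : ∀ {k} (G : Graph k) o u → + outdeg G o u - + indeg G o u ≡ net G o u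
outdeg-indeg≡net G o u = begin
  + outdeg G o u - + indeg G o u
    ≡⟨ cong₂ _-_ (sumList-allFin (length G) leaves) (sumList-allFin (length G) enters) ⟩
  Σ (λ e → + leaves e) - Σ (λ e → + enters e)
    ≡⟨ Σ-distrib-- (λ e → + leaves e) (λ e → + enters e) ⟨
  Σ (λ e → + leaves e - + enters e)
    ≡⟨ sum-cong-≗ (λ e → cong₂ _-_ (ind-count (isV u (tail G o e))) (ind-count (isV u (head G o e)))) ⟩
  net G o u ∎
  where
  open ≡-Reasoning
  leaves enters : Edge G → ℕ
  leaves e = if isV u (tail G o e) then 1 else 0
  enters e = if isV u (head G o e) then 1 else 0

isBeta⇒net≡₃ : ∀ {k} (G : Graph k) {o β} → IsBetaOrientation G o β → ∀ u → net G o u ≡₃ + toℕ (β u)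
isBeta⇒net≡₃ G {o} {β} isβ u = subst₂ _≡₃_ (outdeg-indeg≡net G o u) (cong +_ (isβ u)) (≡₃-residue _)

net≡₃⇒isBeta : ∀ {k} (G : Graph k) {o β} → (∀ u → net G o u ≡₃ + toℕ (β u)) → IsBetaOrientation G o β
net≡₃⇒isBeta G {o} {β} p u = ≡₃⇒residue (toℕ<n (β u)) (subst (_≡₃ + toℕ (β u)) (sym (outdeg-indeg≡net G o u)) (p u))

zeroSum⇒Σ≡₃0 : ∀ {k} {β : Fin k → Fin 3} → ZeroSum3 β → Σ (λ u → + toℕ (β u)) ≡₃ + 0
zeroSum⇒Σ≡₃0 {k} {β} zs = subst₂ _≡₃_ (sumList-allFin k (toℕ ∘ β)) (cong +_ zs) (≡₃-residue _)

Σ≡₃0⇒zeroSum : ∀ {k} {β : Fin k → Fin 3} → Σ (λ u → + toℕ (β u)) ≡₃ + 0 → ZeroSum3 β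
Σ≡₃0⇒zeroSum {k} {β} p = ≡₃⇒residue (s≤s z≤n) (subst (_≡₃ + 0) (sym (sumList-allFin k (toℕ ∘ β))) p)

Reach-trans : ∀ {k} {G : Graph k} {o} {x y z} → Reach G o x y → Reach G o y z → Reach G o x z
Reach-trans here q = q
Reach-trans (step e t≡x r) q = step e t≡x (Reach-trans r q)

arc-reach : ∀ {k} {G : Graph k} {o} {x y} (e : Edge G) → arc G o e ≡ (x , y) → Reach G o x y
arc-reach e refl = step e refl here

reach-map : ∀ {k l} {G : Graph k} {o} {H : Graph l} {p} (φ : Fin k → Fin l) →
  (∀ e → Reach H p (φ (tail G o e)) (φ (head G o e))) →
  ∀ {x y} → Reach G o x y → Reach H p (φ x) (φ y)
reach-map φ arcs here = here
reach-map φ arcs (step e refl r) = Reach-trans (arcs e) (reach-map φ arcs r)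

count : ∀ {m} → (Fin m → Bool) → ℕ
count {zero} s = 0
count {suc m} s = (if s zero then 1 else 0) ℕ.+ count (s ∘ suc)

deg≡count : ∀ {k} (G : Graph k) v → deg G v ≡ count (λ e → incident v (lookup G e))
deg≡count [] v = refl
deg≡count (p ∷ G) v = cong (ℕ._+_ (if incident v p then 1 else 0)) (deg≡count G v)

_∖_ : ∀ {m} → (Fin m → Bool) → Fin m → Fin m → Bool
(s ∖ i) e = if does (e ≟ i) then false else s e

count-remove : ∀ {m} (s : Fin m → Bool) i → s i ≡ true → count s ≡ suc (count (s ∖ i))
count-remove s zero si rewrite si = refl
count-remove s (suc i) si rewrite count-remove (s ∘ suc) i si =
  ℕP.+-suc (if s zero then 1 else 0) (count ((s ∘ suc) ∖ i))

∖-keeps : ∀ {m} (s : Fin m → Bool) {i e} → e ≢ i → (s ∖ i) e ≡ s e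
∖-keeps s {i} {e} e≢i rewrite dec-false (e ≟ i) e≢i = refl

∖-sub : ∀ {m} (s : Fin m → Bool) {i e} → (s ∖ i) e ≡ true → s e ≡ true
∖-sub s {i} {e} sₑ with does (e ≟ i)
... | false = sₑ

∖-excludes : ∀ {m} (s : Fin m → Bool) {i e} → (s ∖ i) e ≡ true → e ≢ i
∖-excludes s {i} {e} sₑ refl rewrite dec-true (e ≟ e) refl with () ← sₑ

∖-comm : ∀ {m} (s : Fin m → Bool) i j e → ((s ∖ i) ∖ j) e ≡ ((s ∖ j) ∖ i) e
∖-comm s i j e with does (e ≟ i) | does (e ≟ j)
... | true | true = refl
... | true | false = refl
... | false | true = refl
... | false | false = refl

Σ⟨_⟩ : ∀ {m} → (Fin m → Bool) → (Fin m → ℤ) → ℤ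
Σ⟨ s ⟩ g = Σ (λ e → if s e then g e else + 0)

signed-count : ∀ {m} (s : Fin m → Bool) (F : Fin m → Bool → ℤ) →
  (∀ i → s i ≡ true → ∃ λ b → F i b ≡ + 1) → (∀ i → s i ≡ true → ∃ λ b → F i b ≡ - + 1) →
  ∀ j → j ≤ count s → ∃ λ (c : Fin m → Bool) →
    Σ⟨ s ⟩ (λ i → F i (c i)) ≡ + count s - (+ j + + j)
signed-count {zero} s F plus minus zero z≤n = (λ ()) , refl
signed-count {suc m} s F plus minus j j≤ with s zero in s₀
... | false with signed-count (s ∘ suc) (F ∘ suc) (plus ∘ suc) (minus ∘ suc) j j≤
...   | c , eq = false ∷ᶠ c , trans (ℤP.+-identityˡ _) eq
signed-count {suc m} s F plus minus zero j≤ | true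
  with plus zero s₀ | signed-count (s ∘ suc) (F ∘ suc) (plus ∘ suc) (minus ∘ suc) zero z≤n
... | b , F₀ | c , eq = b ∷ᶠ c , trans (cong₂ _+_ F₀ eq)
  (solve 1 (λ K → con (+ 1) :+ (K :- (con (+ 0) :+ con (+ 0))) := (con (+ 1) :+ K) :- (con (+ 0) :+ con (+ 0)))
         refl (+ count (s ∘ suc)))
signed-count {suc m} s F plus minus (suc j) (s≤s j≤) | true
  with minus zero s₀ | signed-count (s ∘ suc) (F ∘ suc) (plus ∘ suc) (minus ∘ suc) j j≤
... | b , F₀ | c , eq = b ∷ᶠ c , trans (cong₂ _+_ F₀ eq)
  (solve 2 (λ K J → (:- con (+ 1)) :+ (K :- (J :+ J)) := (con (+ 1) :+ K) :- ((con (+ 1) :+ J) :+ (con (+ 1) :+ J)))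
         refl (+ count (s ∘ suc)) (+ j))

-- For every k and r some j < 3 has k - 2j ≡ r (mod 3): take j ≡ r - k.
halving-mod3 : ∀ k r → ∃ λ j → j < 3 × + k - (+ j + + j) ≡₃ + r
halving-mod3 k r = j , n%ℕd<d (+ r - + k) 3 , (begin
  + k - (+ j + + j)                     ≈⟨ ≡₃-- (≡₃-reflexive {+ k} refl) (≡₃-+ j≡r-k j≡r-k) ⟩
  + k - ((+ r - + k) + (+ r - + k))     ≡⟨ solve 2 (λ K R → K :- ((R :- K) :+ (R :- K)) := R :+ (K :- R) :* con (+ 3)) refl (+ k) (+ r) ⟩
  + r + (+ k - + r) * + 3               ≈⟨ mod3 (+ k - + r) refl ⟩
  + r                                   ∎)
  where
  open ≡₃-Reasoning
  j : ℕ
  j = (+ r - + k) %ℕ 3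
  j≡r-k : + j ≡₃ + r - + k
  j≡r-k = ≡₃-sym (≡₃-residue (+ r - + k))

leave-or-enter : ∀ {k} (v : Fin k) (p : Fin k × Fin k) → proj₁ p ≢ proj₂ p → incident v p ≡ true →
  (∃ λ b → δ v (orient p b) ≡ + 1) × (∃ λ b → δ v (orient p b) ≡ - + 1)
leave-or-enter v (x , y) x≢y at-v with isV v x in x?
... | true with refl ← isV-true x? =
  (true , cong₂ (λ p q → ind p - ind q) (isV-refl v) (isV-≢ (x≢y ∘ sym))) ,
  (false , cong₂ (λ p q → ind p - ind q) (isV-≢ (x≢y ∘ sym)) (isV-refl v))
... | false with refl ← isV-true at-v =
  (false , cong₂ (λ p q → ind p - ind q) (isV-refl v) (isV-≢ x≢y)) ,
  (true , cong₂ (λ p q → ind p - ind q) (isV-≢ x≢y) (isV-refl v))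

selectedNet : ∀ {k} (G : Graph k) → (Edge G → Bool) → Orientation G → Fin k → ℤ
selectedNet G s c u = Σ⟨ s ⟩ (λ e → δ u (arc G c e))

Σ-select-remove : ∀ {m} (s : Fin m → Bool) (g : Fin m → ℤ) i → s i ≡ true →
  Σ⟨ s ⟩ g ≡ g i + Σ⟨ s ∖ i ⟩ g
Σ-select-remove s g zero sᵢ rewrite sᵢ = cong (_+_ (g zero)) (sym (ℤP.+-identityˡ _))
Σ-select-remove s g (suc i) sᵢ rewrite Σ-select-remove (s ∘ suc) (g ∘ suc) i sᵢ =
  x∙yz≈y∙xz (if s zero then g zero else + 0) (g (suc i)) (Σ⟨ (s ∘ suc) ∖ i ⟩ (g ∘ suc))

Σ-select-cong : ∀ {m} {s s' : Fin m → Bool} {g g' : Fin m → ℤ} → (∀ e → s e ≡ s' e) →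
  (∀ e → s e ≡ true → g e ≡ g' e) → Σ⟨ s ⟩ g ≡ Σ⟨ s' ⟩ g'
Σ-select-cong {s = s} {s'} {g} {g'} s≡s' g≡g' = sum-cong-≗ pointwise
  where
  pointwise : ∀ e → (if s e then g e else + 0) ≡ (if s' e then g' e else + 0)
  pointwise e rewrite sym (s≡s' e) with s e in sₑ
  ... | true = g≡g' e sₑ
  ... | false = refl

Σ-selectedNet : ∀ {k} (G : Graph k) s c → Σ (selectedNet G s c) ≡ + 0
Σ-selectedNet {k} G s c = trans (∑-comm (λ u e → if s e then δ u (arc G c e) else + 0))
  (trans (sum-cong-≗ per-edge) (sum-replicate-zero (length G)))
  where
  per-edge : ∀ e → Σ (λ u → if s e then δ u (arc G c e) else + 0) ≡ + 0
  per-edge e with s e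
  ... | true = Σ-δ (tail G c e) (head G c e)
  ... | false = sum-replicate-zero k

orient-star : ∀ {k} (G : Graph k) → Loopless G → (v : Fin k) (s : Edge G → Bool) →
  (∀ e → s e ≡ true → incident v (lookup G e) ≡ true) → 2 ≤ count s →
  ∀ r → ∃ λ (c : Orientation G) → selectedNet G s c v ≡₃ + r
orient-star G loopless v s at-v two r with halving-mod3 (count s) r
... | j , j<3 , count-2j≡r
  with signed-count s (λ e b → δ v (orient (lookup G e) b)) (λ e se → proj₁ (signs e se))
         (λ e se → proj₂ (signs e se)) j (ℕP.≤-trans (ℕP.≤-pred j<3) two)
  where
  signs : ∀ e → s e ≡ true →
    (∃ λ b → δ v (orient (lookup G e) b) ≡ + 1) × (∃ λ b → δ v (orient (lookup G e) b) ≡ - + 1)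
  signs e se = leave-or-enter v (lookup G e) (All.lookup loopless (∈-lookup e)) (at-v e se)
... | c , eq = c , ≡₃-trans (≡₃-reflexive eq) count-2j≡r

module VertexDeletion {n : ℕ} (v : Fin (suc n)) where

  incident-avoiding : ∀ {x y} → v ≢ x → v ≢ y → incident v (x , y) ≡ false
  incident-avoiding v≢x v≢y rewrite isV-≢ (v≢x ∘ sym) | isV-≢ (v≢y ∘ sym) = refl

  incident-tail : ∀ {x y} → v ≡ x → incident v (x , y) ≡ true
  incident-tail refl rewrite isV-refl v = refl

  incident-head : ∀ {x y} → v ≡ y → incident v (x , y) ≡ true
  incident-head {x} refl with isV v x
  ... | true = refl
  ... | false = isV-refl v

  Joins⇒incident : ∀ {G : Graph (suc n)} {e x} → Joins G e v x → incident v (lookup G e) ≡ true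
  Joins⇒incident (inj₁ eq) rewrite eq = incident-tail refl
  Joins⇒incident (inj₂ eq) rewrite eq = incident-head refl

  atV : (G : Graph (suc n)) → Edge G → Bool
  atV G e = incident v (lookup G e)

  starNet : (G : Graph (suc n)) → Orientation G → Fin (suc n) → ℤ
  starNet G = selectedNet G (atV G)

  glue : (G : Graph (suc n)) → Orientation (deleteV v G) → Orientation G → Orientation G
  glue ((x , y) ∷ es) p f with v ≟ x | v ≟ y
  ... | no _  | no _  = p zero ∷ᶠ glue es (p ∘ suc) (f ∘ suc)
  ... | yes _ | _     = f zero ∷ᶠ glue es p (f ∘ suc)
  ... | no _  | yes _ = f zero ∷ᶠ glue es p (f ∘ suc)

  δ-punchIn : ∀ w x y → δ (punchIn v w) (punchIn v x , punchIn v y) ≡ δ w (x , y)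
  δ-punchIn w x y = cong₂ (λ p q → ind p - ind q) (isV-punchIn v w x) (isV-punchIn v w y)

  δ-punchOut : ∀ {x y} w (v≢x : v ≢ x) (v≢y : v ≢ y) →
    δ (punchIn v w) (x , y) ≡ δ w (punchOut v≢x , punchOut v≢y)
  δ-punchOut w v≢x v≢y = trans
    (cong (δ (punchIn v w)) (sym (cong₂ _,_ (punchIn-punchOut v≢x) (punchIn-punchOut v≢y))))
    (δ-punchIn w (punchOut v≢x) (punchOut v≢y))

  δ-orient-punchOut : ∀ {x y} w (v≢x : v ≢ x) (v≢y : v ≢ y) b →
    δ (punchIn v w) (orient (x , y) b) ≡ δ w (orient (punchOut v≢x , punchOut v≢y) b)
  δ-orient-punchOut w v≢x v≢y true = δ-punchOut w v≢x v≢y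
  δ-orient-punchOut w v≢x v≢y false = δ-punchOut w v≢y v≢x

  δ-avoiding : ∀ {x y} → v ≢ x → v ≢ y → δ v (x , y) ≡ + 0
  δ-avoiding v≢x v≢y = cong₂ (λ p q → ind p - ind q) (isV-≢ (v≢x ∘ sym)) (isV-≢ (v≢y ∘ sym))

  δ-orient-avoiding : ∀ {x y} → v ≢ x → v ≢ y → ∀ b → δ v (orient (x , y) b) ≡ + 0
  δ-orient-avoiding v≢x v≢y true = δ-avoiding v≢x v≢y
  δ-orient-avoiding v≢x v≢y false = δ-avoiding v≢y v≢x

  glue-net-away : ∀ G p f (w : Fin n) →
    net G (glue G p f) (punchIn v w) ≡ net (deleteV v G) p w + starNet G f (punchIn v w)
  glue-net-away [] p f w = refl
  glue-net-away ((x , y) ∷ es) p f w with v ≟ x | v ≟ y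
  ... | no v≢x | no v≢y rewrite incident-avoiding v≢x v≢y =
    trans (cong₂ _+_ (δ-orient-punchOut w v≢x v≢y (p zero)) (glue-net-away es (p ∘ suc) (f ∘ suc) w))
          (trans (sym (ℤP.+-assoc A B C)) (cong (_+_ (A + B)) (sym (ℤP.+-identityˡ C))))
    where
    A B C : ℤ
    A = δ w (orient (punchOut v≢x , punchOut v≢y) (p zero))
    B = net (deleteV v es) (p ∘ suc) w
    C = starNet es (f ∘ suc) (punchIn v w)
  ... | yes v≡x | _ rewrite incident-tail {y = y} v≡x =
    trans (cong (_+_ D) (glue-net-away es p (f ∘ suc) w))
          (x∙yz≈y∙xz D (net (deleteV v es) p w) (starNet es (f ∘ suc) (punchIn v w)))
    where
    D : ℤ
    D = δ (punchIn v w) (orient (x , y) (f zero))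
  ... | no _ | yes v≡y rewrite incident-head {x} v≡y =
    trans (cong (_+_ D) (glue-net-away es p (f ∘ suc) w))
          (x∙yz≈y∙xz D (net (deleteV v es) p w) (starNet es (f ∘ suc) (punchIn v w)))
    where
    D : ℤ
    D = δ (punchIn v w) (orient (x , y) (f zero))

  glue-net-at : ∀ G p f → net G (glue G p f) v ≡ starNet G f v
  glue-net-at [] p f = refl
  glue-net-at ((x , y) ∷ es) p f with v ≟ x | v ≟ y
  ... | no v≢x | no v≢y rewrite incident-avoiding v≢x v≢y =
    cong₂ _+_ (δ-orient-avoiding v≢x v≢y (p zero)) (glue-net-at es (p ∘ suc) (f ∘ suc))
  ... | yes v≡x | _ rewrite incident-tail {y = y} v≡x =
    cong (_+_ (δ v (orient (x , y) (f zero)))) (glue-net-at es p (f ∘ suc))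
  ... | no _ | yes v≡y rewrite incident-head {x} v≡y =
    cong (_+_ (δ v (orient (x , y) (f zero)))) (glue-net-at es p (f ∘ suc))

  glue-at : ∀ G p f e → atV G e ≡ true → glue G p f e ≡ f e
  glue-at ((x , y) ∷ es) p f e at-v with v ≟ x | v ≟ y
  glue-at ((x , y) ∷ es) p f zero at-v | no v≢x | no v≢y
    with () ← trans (sym at-v) (incident-avoiding v≢x v≢y)
  glue-at ((x , y) ∷ es) p f zero at-v | yes _ | _ = refl
  glue-at ((x , y) ∷ es) p f zero at-v | no _ | yes _ = refl
  glue-at ((x , y) ∷ es) p f (suc e) at-v | no _ | no _ = glue-at es (p ∘ suc) (f ∘ suc) e at-v
  glue-at ((x , y) ∷ es) p f (suc e) at-v | yes _ | _ = glue-at es p (f ∘ suc) e at-v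
  glue-at ((x , y) ∷ es) p f (suc e) at-v | no _ | yes _ = glue-at es p (f ∘ suc) e at-v

  glue-lift : ∀ G p f (e' : Edge (deleteV v G)) → ∃ λ (e : Edge G) →
    arc G (glue G p f) e ≡ (punchIn v (tail (deleteV v G) p e') , punchIn v (head (deleteV v G) p e'))
  glue-lift ((x , y) ∷ es) p f e' with v ≟ x | v ≟ y
  glue-lift ((x , y) ∷ es) p f zero | no v≢x | no v≢y with p zero
  ... | true = zero , sym (cong₂ _,_ (punchIn-punchOut v≢x) (punchIn-punchOut v≢y))
  ... | false = zero , sym (cong₂ _,_ (punchIn-punchOut v≢y) (punchIn-punchOut v≢x))
  glue-lift ((x , y) ∷ es) p f (suc e') | no _ | no _ =
    let (e , eq) = glue-lift es (p ∘ suc) (f ∘ suc) e' in suc e , eq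
  glue-lift ((x , y) ∷ es) p f e' | yes _ | _ =
    let (e , eq) = glue-lift es p (f ∘ suc) e' in suc e , eq
  glue-lift ((x , y) ∷ es) p f e' | no _ | yes _ =
    let (e , eq) = glue-lift es p (f ∘ suc) e' in suc e , eq

  glue-arc-at : ∀ G p f e → atV G e ≡ true → arc G (glue G p f) e ≡ arc G f e
  glue-arc-at G p f e at-v = cong (orient (lookup G e)) (glue-at G p f e at-v)

  split-vertex : (P : Fin (suc n) → Set) → P v → (∀ w → P (punchIn v w)) → ∀ u → P u
  split-vertex P Pv Pw u with u ≟ v
  ... | yes refl = Pv
  ... | no u≢v = subst P (punchIn-punchOut (u≢v ∘ sym)) (Pw (punchOut (u≢v ∘ sym)))

  two-more-edges : ∀ (G : Graph (suc n)) {e₁ e₂} → 4 ≤ deg G v → e₁ ≢ e₂ →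
    atV G e₁ ≡ true → atV G e₂ ≡ true → 2 ≤ count ((atV G ∖ e₁) ∖ e₂)
  two-more-edges G {e₁} {e₂} deg≥4 e₁≢e₂ at₁ at₂ = ℕP.≤-pred (ℕP.≤-pred (subst (4 ≤_) deg≡ deg≥4))
    where
    deg≡ : deg G v ≡ suc (suc (count ((atV G ∖ e₁) ∖ e₂)))
    deg≡ = trans (deg≡count G v) (trans (count-remove (atV G) e₁ at₁)
             (cong suc (count-remove (atV G ∖ e₁) e₂ (trans (∖-keeps (atV G) (e₁≢e₂ ∘ sym)) at₂))))

  -- the demand on G - v left over when the edges at v take care of the net outflow R
  reduce : (Fin (suc n) → Fin 3) → (Fin (suc n) → ℤ) → Fin n → Fin 3
  reduce β R w = fromℕ< (n%ℕd<d (+ toℕ (β (punchIn v w)) - R (punchIn v w)) 3)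

  reduce-≡₃ : ∀ β R w → + toℕ (reduce β R w) ≡₃ + toℕ (β (punchIn v w)) - R (punchIn v w)
  reduce-≡₃ β R w = subst (_≡₃ X) (cong +_ (sym (toℕ-fromℕ< (n%ℕd<d X 3)))) (≡₃-sym (≡₃-residue X))
    where
    X : ℤ
    X = + toℕ (β (punchIn v w)) - R (punchIn v w)

  Σ-punchIn : (g : Fin (suc n) → ℤ) → Σ (g ∘ punchIn v) ≡ Σ g - g v
  Σ-punchIn g = trans (solve 2 (λ x y → y := (x :+ y) :- x) refl (g v) (Σ (g ∘ punchIn v)))
                      (cong (_- g v) (sym (sum-remove {i = v} g)))

  reduce-zeroSum : ∀ β R → ZeroSum3 β → Σ R ≡ + 0 → R v ≡₃ + toℕ (β v) → ZeroSum3 (reduce β R)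
  reduce-zeroSum β R zs ΣR≡0 Rv≡ = Σ≡₃0⇒zeroSum {β = reduce β R} (begin
    Σ (λ w → + toℕ (reduce β R w))          ≈⟨ Σ-≡₃ (reduce-≡₃ β R) ⟩
    Σ (λ w → B (punchIn v w) - R (punchIn v w))
                                             ≡⟨ Σ-distrib-- (B ∘ punchIn v) (R ∘ punchIn v) ⟩
    Σ (B ∘ punchIn v) - Σ (R ∘ punchIn v)    ≡⟨ cong₂ _-_ (Σ-punchIn B) (Σ-punchIn R) ⟩
    (Σ B - B v) - (Σ R - R v)                ≈⟨ ≡₃-- (≡₃-- (zeroSum⇒Σ≡₃0 {β = β} zs) (≡₃-reflexive refl))
                                                     (≡₃-- (≡₃-reflexive ΣR≡0) Rv≡) ⟩
    (+ 0 - B v) - (+ 0 - B v)                ≡⟨ solve 1 (λ x → (con (+ 0) :- x) :- (con (+ 0) :- x) := con (+ 0)) refl (B v) ⟩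
    + 0                                      ∎)
    where
    open ≡₃-Reasoning
    B : Fin (suc n) → ℤ
    B u = + toℕ (β u)

module Gluing {n : ℕ} (v : Fin (suc n)) (G : Graph (suc n)) (e₀ : Fin n × Fin n) where
  open VertexDeletion v

  G' : Graph n
  G' = e₀ ∷ deleteV v G

  record Detour (o' : Orientation G') (f : Orientation G) (R : Fin (suc n) → ℤ) : Set where
    field
      eIn eOut : Edge G
      eIn-at : atV G eIn ≡ true
      eOut-at : atV G eOut ≡ true
      eIn-arc : arc G f eIn ≡ (punchIn v (tail G' o' zero) , v)
      eOut-arc : arc G f eOut ≡ (v , punchIn v (head G' o' zero))
      star : ∀ u → starNet G f u ≡ δ u (punchIn v (tail G' o' zero) , punchIn v (head G' o' zero)) + R u

  module _ {o' : Orientation G'} {f : Orientation G} {R : Fin (suc n) → ℤ} (d : Detour o' f R) where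
    open Detour d

    t' h' : Fin n
    t' = tail G' o' zero
    h' = head G' o' zero

    glued : Orientation G
    glued = glue G (o' ∘ suc) f

    glued-net-away : ∀ w → net G glued (punchIn v w) ≡ net G' o' w + R (punchIn v w)
    glued-net-away w = begin
      net G glued (punchIn v w)                                   ≡⟨ glue-net-away G (o' ∘ suc) f w ⟩
      N + starNet G f (punchIn v w)                               ≡⟨ cong (_+_ N) (star (punchIn v w)) ⟩
      N + (δ (punchIn v w) (punchIn v t' , punchIn v h') + R (punchIn v w))
                                                                  ≡⟨ cong (λ z → N + (z + R (punchIn v w))) (δ-punchIn w t' h') ⟩
      N + (δ w (t' , h') + R (punchIn v w))                       ≡⟨ x∙yz≈y∙xz N (δ w (t' , h')) (R (punchIn v w)) ⟩
      δ w (t' , h') + (N + R (punchIn v w))                       ≡⟨ ℤP.+-assoc (δ w (t' , h')) N (R (punchIn v w)) ⟨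
      net G' o' w + R (punchIn v w)                               ∎
      where
      open ≡-Reasoning
      N : ℤ
      N = net (deleteV v G) (o' ∘ suc) w

    glued-net-at : net G glued v ≡ R v
    glued-net-at = begin
      net G glued v                                       ≡⟨ glue-net-at G (o' ∘ suc) f ⟩
      starNet G f v                                       ≡⟨ star v ⟩
      δ v (punchIn v t' , punchIn v h') + R v             ≡⟨ cong (_+ R v) (δ-avoiding (punchInᵢ≢i v t' ∘ sym) (punchInᵢ≢i v h' ∘ sym)) ⟩
      + 0 + R v                                           ≡⟨ ℤP.+-identityˡ (R v) ⟩
      R v                                                 ∎
      where open ≡-Reasoning

    glued-isBeta : ∀ {β : Fin (suc n) → Fin 3} {β' : Fin n → Fin 3} → IsBetaOrientation G' o' β' →
      (∀ w → + toℕ (β' w) ≡₃ + toℕ (β (punchIn v w)) - R (punchIn v w)) → R v ≡₃ + toℕ (β v) →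
      IsBetaOrientation G glued β
    glued-isBeta {β} {β'} isβ' β'≡ Rv≡ = net≡₃⇒isBeta G (split-vertex (λ u → net G glued u ≡₃ + toℕ (β u)) at-v away)
      where
      open ≡₃-Reasoning
      at-v : net G glued v ≡₃ + toℕ (β v)
      at-v = ≡₃-trans (≡₃-reflexive glued-net-at) Rv≡
      away : ∀ w → net G glued (punchIn v w) ≡₃ + toℕ (β (punchIn v w))
      away w = begin
        net G glued (punchIn v w)              ≡⟨ glued-net-away w ⟩
        net G' o' w + R (punchIn v w)          ≈⟨ ≡₃-+ (≡₃-trans (isBeta⇒net≡₃ G' {o'} isβ' w) (β'≡ w)) (≡₃-reflexive refl) ⟩
        + toℕ (β (punchIn v w)) - R (punchIn v w) + R (punchIn v w)
                                               ≡⟨ solve 2 (λ B X → B :- X :+ X := B) refl (+ toℕ (β (punchIn v w))) (R (punchIn v w)) ⟩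
        + toℕ (β (punchIn v w))                ∎

    -- every arc of o' is realised by a walk of the glued orientation; e₀ by the detour through v
    glued-strong : StronglyConnected G' o' → StronglyConnected G glued
    glued-strong sc' = split-vertex (λ x → ∀ y → Reach G glued x y)
      (split-vertex (Reach G glued v) here (λ w → Reach-trans out-of-v (lift (sc' h' w))))
      (λ w → split-vertex (Reach G glued (punchIn v w)) (Reach-trans (lift (sc' w t')) into-v) (lift ∘ sc' w))
      where
      into-v : Reach G glued (punchIn v t') v
      into-v = arc-reach eIn (trans (glue-arc-at G (o' ∘ suc) f eIn eIn-at) eIn-arc)
      out-of-v : Reach G glued v (punchIn v h')
      out-of-v = arc-reach eOut (trans (glue-arc-at G (o' ∘ suc) f eOut eOut-at) eOut-arc)
      arcs : ∀ e' → Reach G glued (punchIn v (tail G' o' e')) (punchIn v (head G' o' e'))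
      arcs zero = Reach-trans into-v out-of-v
      arcs (suc e') = let (e , eq) = glue-lift G (o' ∘ suc) f e' in arc-reach e eq
      lift : ∀ {x y} → Reach G' o' x y → Reach G glued (punchIn v x) (punchIn v y)
      lift = reach-map (punchIn v) arcs

  route : (o' : Orientation G') (c : Orientation G) {eIn eOut : Edge G} {t h : Fin (suc n)} →
    eIn ≢ eOut → Joins G eIn v t → Joins G eOut v h →
    punchIn v (tail G' o' zero) ≡ t → punchIn v (head G' o' zero) ≡ h →
    (s : Edge G → Bool) → (∀ e → s e ≡ ((atV G ∖ eIn) ∖ eOut) e) →
    ∃ λ (f : Orientation G) → Detour o' f (selectedNet G s c)
  route o' c {eIn} {eOut} {t} {h} eIn≢eOut eIn∼t eOut∼h refl refl s s≡ = f , record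
    { eIn = eIn ; eOut = eOut ; eIn-at = eIn-at ; eOut-at = eOut-at
    ; eIn-arc = trans (cong (orient (lookup G eIn)) f-eIn) orient-in
    ; eOut-arc = trans (cong (orient (lookup G eOut)) f-eOut) orient-out
    ; star = star }
    where
    eIn-at : atV G eIn ≡ true
    eIn-at = Joins⇒incident {G} eIn∼t
    eOut-at : atV G eOut ≡ true
    eOut-at = Joins⇒incident {G} eOut∼h

    into : ∃ λ b → orient (lookup G eIn) b ≡ (t , v)
    into = Joins⇒orient {G = G} (Joins-sym {G = G} eIn∼t)
    bIn : Bool
    bIn = proj₁ into
    orient-in : orient (lookup G eIn) bIn ≡ (t , v)
    orient-in = proj₂ into
    out : ∃ λ b → orient (lookup G eOut) b ≡ (v , h)
    out = Joins⇒orient {G = G} eOut∼h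
    bOut : Bool
    bOut = proj₁ out
    orient-out : orient (lookup G eOut) bOut ≡ (v , h)
    orient-out = proj₂ out

    f : Orientation G
    f e = if does (e ≟ eIn) then bIn else if does (e ≟ eOut) then bOut else c e

    f-eIn : f eIn ≡ bIn
    f-eIn rewrite dec-true (eIn ≟ eIn) refl = refl
    f-eOut : f eOut ≡ bOut
    f-eOut rewrite dec-false (eOut ≟ eIn) (eIn≢eOut ∘ sym) | dec-true (eOut ≟ eOut) refl = refl
    f-other : ∀ e → ((atV G ∖ eIn) ∖ eOut) e ≡ true → f e ≡ c e
    f-other e sₑ rewrite dec-false (e ≟ eIn) (∖-excludes (atV G) (∖-sub (atV G ∖ eIn) {eOut} {e} sₑ))
                       | dec-false (e ≟ eOut) (∖-excludes (atV G ∖ eIn) {eOut} {e} sₑ) = refl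

    star : ∀ u → starNet G f u ≡ δ u (t , h) + selectedNet G s c u
    star u = begin
      starNet G f u
        ≡⟨ Σ-select-remove (atV G) (δ u ∘ arc G f) eIn eIn-at ⟩
      δ u (arc G f eIn) + Σ⟨ atV G ∖ eIn ⟩ (λ e → δ u (arc G f e))
        ≡⟨ cong (_+_ (δ u (arc G f eIn))) (Σ-select-remove (atV G ∖ eIn) (δ u ∘ arc G f) eOut
             (trans (∖-keeps (atV G) (eIn≢eOut ∘ sym)) eOut-at)) ⟩
      δ u (arc G f eIn) + (δ u (arc G f eOut) + others)
        ≡⟨ cong₂ (λ x y → δ u x + (δ u y + others)) (trans (cong (orient (lookup G eIn)) f-eIn) orient-in)
                                                    (trans (cong (orient (lookup G eOut)) f-eOut) orient-out) ⟩
      δ u (t , v) + (δ u (v , h) + others)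
        ≡⟨ cong (λ z → δ u (t , v) + (δ u (v , h) + z))
             (Σ-select-cong {g = δ u ∘ arc G f} (sym ∘ s≡) (λ e sₑ → cong (δ u ∘ orient (lookup G e)) (f-other e sₑ))) ⟩
      δ u (t , v) + (δ u (v , h) + selectedNet G s c u)
        ≡⟨ ℤP.+-assoc (δ u (t , v)) (δ u (v , h)) (selectedNet G s c u) ⟨
      δ u (t , v) + δ u (v , h) + selectedNet G s c u
        ≡⟨ cong (_+ selectedNet G s c u) (δ-path u t v h) ⟩
      δ u (t , h) + selectedNet G s c u ∎
      where
      open ≡-Reasoning
      others : ℤ
      others = Σ⟨ (atV G ∖ eIn) ∖ eOut ⟩ (λ e → δ u (arc G f e))

  route-e₀ : (c : Orientation G) {ea eb : Edge G} {a b : Fin (suc n)} → ea ≢ eb →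
    Joins G ea v a → Joins G eb v b → punchIn v (proj₁ e₀) ≡ a → punchIn v (proj₂ e₀) ≡ b →
    (p : Orientation G') → ∃ λ f → Detour p f (selectedNet G ((atV G ∖ ea) ∖ eb) c)
  route-e₀ c {ea} {eb} ea≢eb ea∼a eb∼b a≡ b≡ p = along (p zero) refl
    where
    end : ∀ {dir} → p zero ≡ dir → (x y : Fin n) →
      punchIn v (if p zero then x else y) ≡ punchIn v (if dir then x else y)
    end p₀ x y = cong (λ d → punchIn v (if d then x else y)) p₀
    along : ∀ dir → p zero ≡ dir → ∃ λ f → Detour p f (selectedNet G ((atV G ∖ ea) ∖ eb) c)
    along true p₀ = route p c ea≢eb ea∼a eb∼b
      (trans (end p₀ (proj₁ e₀) (proj₂ e₀)) a≡) (trans (end p₀ (proj₂ e₀) (proj₁ e₀)) b≡)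
      ((atV G ∖ ea) ∖ eb) (λ _ → refl)
    along false p₀ = route p c (ea≢eb ∘ sym) eb∼b ea∼a
      (trans (end p₀ (proj₁ e₀) (proj₂ e₀)) b≡) (trans (end p₀ (proj₂ e₀) (proj₁ e₀)) a≡)
      ((atV G ∖ ea) ∖ eb) (∖-comm (atV G) ea eb)

lemma2p11 : (n : ℕ) (G : Graph (suc n)) → Loopless G →
    (v : Fin (suc n)) → 4 ≤ deg G v →
    (a b : Fin (suc n)) (va vb : Edge G) → va ≢ vb → a ≢ b →
    Joins G va v a → Joins G vb v b →
    (v≢a : v ≢ a) (v≢b : v ≢ b) →
    S3 (liftAt G v a b v≢a v≢b) → S3 G
lemma2p11 n G loopless v deg≥4 a b va vb va≢vb _ va∼a vb∼b v≢a v≢b G'∈S3 β zeroSum =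
  glued d , glued-isBeta d isβ' (reduce-≡₃ β R) Rv≡βv , glued-strong d sc'
  where
  open VertexDeletion v
  open Gluing v G (punchOut v≢a , punchOut v≢b)

  s : Edge G → Bool
  s = (atV G ∖ va) ∖ vb
  others : ∃ λ c → selectedNet G s c v ≡₃ + toℕ (β v)
  others = orient-star G loopless v s (λ e → ∖-sub (atV G) ∘ ∖-sub (atV G ∖ va) {vb} {e})
    (two-more-edges G deg≥4 va≢vb (Joins⇒incident {G} va∼a) (Joins⇒incident {G} vb∼b)) (toℕ (β v))
  R : Fin (suc n) → ℤ
  R = selectedNet G s (proj₁ others)
  Rv≡βv : R v ≡₃ + toℕ (β v)
  Rv≡βv = proj₂ others

  reduced : ∃ λ o' → IsBetaOrientation G' o' (reduce β R) × StronglyConnected G' o'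
  reduced = G'∈S3 (reduce β R) (reduce-zeroSum β R zeroSum (Σ-selectedNet G s (proj₁ others)) Rv≡βv)
  o' : Orientation G'
  o' = proj₁ reduced
  isβ' : IsBetaOrientation G' o' (reduce β R)
  isβ' = proj₁ (proj₂ reduced)
  sc' : StronglyConnected G' o'
  sc' = proj₂ (proj₂ reduced)

  detour : ∃ λ f → Detour o' f R
  detour = route-e₀ (proj₁ others) va≢vb va∼a vb∼b (punchIn-punchOut v≢a) (punchIn-punchOut v≢b) o'
  d : Detour o' (proj₁ detour) R
  d = proj₂ detour
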